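{- Let $\mathcal{A},\mathcal{B}$ be pca's with $\mathcal{A}$ a sub-pca of $\mathcal{B}$. (i) For all closed terms $s,t$ over $\mathcal{A}$, $\mathrm{ord}_\mathcal{A}(s,t)\leq\mathrm{ord}_\mathcal{B}(s,t)$. (ii) If for all closed terms $s,t$ over $\mathcal{A}$, $\mathrm{ord}_\mathcal{A}(s,t)<\infty$ implies $\mathrm{ord}_\mathcal{B}(s,t)<\infty$, then $\mathrm{ord}(\mathcal{A})\leq\mathrm{ord}(\mathcal{B})$. (iii) If $\mathcal{A}$ and $\mathcal{B}$ are non-extensional and for all $a,b\in\mathcal{A}$, $\mathrm{ord}_\mathcal{A}(a,b)<\infty$ implies $\mathrm{ord}_\mathcal{B}(a,b)<\infty$, then $\mathrm{ord}(\mathcal{A})\leq\mathrm{ord}(\mathcal{B})$.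
   Context: A pca is a set $\mathcal{A}$ with partial application $ab$ (associating to the left) containing $K,S$ with $Kab$ defined and equal to $a$, and $Sab$ defined with $Sabc\simeq ac(bc)$. $\mathcal{A}$ is a sub-pca of $\mathcal{B}$ if $\mathcal{A}\subseteq\mathcal{B}$ and the application of $\mathcal{A}$ is the restriction of that of $\mathcal{B}$ (no requirement that $\mathcal{A}$ share combinators with $\mathcal{B}$). Closed terms are built from elements by application; $s\simeq t$ means both undefined or both defined and equal. Relations $\sim_\alpha$ in a pca $\mathcal{C}$: $s\sim_0 t$ iff $s\simeq t$; $s \sim_{\alpha+1} t$ iff $sx \sim_\alpha tx$ for all $x\in\mathcal{C}$; for limit $\alpha$, $s\sim_\alpha t$ iff $s\sim_\beta t$ for some $\beta<\alpha$. $s\approx t$ iff $s\sim_\gamma t$ for some $\gamma$. $\mathrm{ord}_\mathcal{C}(s,t)$ is the least $\alpha$ with $s\sim_\alpha t$ in $\mathcal{C}$ if $s\approx t$, and the symbol $\infty$ otherwise, where $\alpha<\infty$ for every ordinal $\alpha$. $\mathrm{ord}(\mathcal{C})$ is the least $\alpha$ with $\sim_\alpha=\sim_{\alpha+1}$ in $\mathcal{C}$. $\mathcal{C}$ is extensional if for all $f,g\in\mathcal{C}$, $f=g$ whenever $fx\simeq gx$ for all $x\in\mathcal{C}$. -}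

module Defs where

open import Level using (Level; _⊔_) renaming (suc to lsuc)
open import Data.Maybe using (Maybe; just; nothing; map; _>>=_)
open import Data.Product using (Σ; _×_; _,_; ∃)
open import Data.Unit using (⊤)
open import Data.Empty using (⊥)
import Data.Unit.Polymorphic
import Data.Empty.Polymorphic
open import Relation.Nullary using (¬_)
open import Relation.Binary.PropositionalEquality using (_≡_; _≢_)
open import Function using (_⇔_)

-- Partial combinatory algebras
-- Partial application is modelled as a total map into Maybe.

module _ {ℓ : Level} (C : Set ℓ) where

  data Term : Set ℓ where
    el  : C → Term
    app : Term → Term → Term

evalWith : ∀ {ℓ} {C : Set ℓ} → (C → C → Maybe C) → Term C → Maybe C
evalWith _·_ (el a)    = just a
evalWith _·_ (app s t) =
  evalWith _·_ s >>= λ a → evalWith _·_ t >>= λ b → a · b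

record PCA (ℓ : Level) : Set (lsuc ℓ) where
  infixl 9 _·_
  field
    Carrier : Set ℓ
    _·_     : Carrier → Carrier → Maybe Carrier
    K S   : Carrier
    K-ax  : ∀ a b → evalWith _·_ (app (app (el K) (el a)) (el b)) ≡ just a
    S-def : ∀ a b → evalWith _·_ (app (app (el S) (el a)) (el b)) ≢ nothing
    S-ax  : ∀ a b c →
            evalWith _·_ (app (app (app (el S) (el a)) (el b)) (el c))
              ≡ evalWith _·_ (app (app (el a) (el c)) (app (el b) (el c)))

  eval : Term Carrier → Maybe Carrier
  eval = evalWith _·_

  _≃_ : Term Carrier → Term Carrier → Set ℓ
  s ≃ t = eval s ≡ eval t

  Extensional : Set ℓ
  Extensional = ∀ f g → (∀ x → (f · x) ≡ (g · x)) → f ≡ g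

record SubPCA {ℓ : Level} (A B : PCA ℓ) : Set ℓ where
  private
    module A = PCA A
    module B = PCA B
  field
    ι     : A.Carrier → B.Carrier
    ι-inj : ∀ a b → ι a ≡ ι b → a ≡ b
    ι-app : ∀ a b → map ι (a A.· b) ≡ (ι a B.· ι b)

  ιT : Term A.Carrier → Term B.Carrier
  ιT (el a)    = el (ι a)
  ιT (app s t) = app (ιT s) (ιT t)

-- Ordinals: Brouwer trees with limits over (inhabited) families
-- indexed by types in Set ℓ; a limit denotes the supremum.

data Ord (ℓ : Level) : Set (lsuc ℓ) where
  zero : Ord ℓ
  succ : Ord ℓ → Ord ℓ
  lim  : (I : Set ℓ) → I → (I → Ord ℓ) → Ord ℓ

mutual
  _≤ₒ_ : ∀ {ℓ} → Ord ℓ → Ord ℓ → Set ℓ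
  zero       ≤ₒ β = Data.Unit.Polymorphic.⊤
  succ α     ≤ₒ β = α <ₒ β
  lim I _ f  ≤ₒ β = ∀ i → f i ≤ₒ β

  _<ₒ_ : ∀ {ℓ} → Ord ℓ → Ord ℓ → Set ℓ
  α <ₒ zero      = Data.Empty.Polymorphic.⊥
  α <ₒ succ β    = α ≤ₒ β
  α <ₒ lim I _ f = Σ I λ i → α <ₒ f i

data Ord∞ (ℓ : Level) : Set (lsuc ℓ) where
  fin : Ord ℓ → Ord∞ ℓ
  ∞   : Ord∞ ℓ

_≤∞_ : ∀ {ℓ} → Ord∞ ℓ → Ord∞ ℓ → Set ℓ
fin α ≤∞ fin β = α ≤ₒ β
_     ≤∞ ∞     = Data.Unit.Polymorphic.⊤
∞     ≤∞ fin _ = Data.Empty.Polymorphic.⊥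

module _ {ℓ : Level} (C : PCA ℓ) where
  open PCA C

  Sim : Ord ℓ → Term Carrier → Term Carrier → Set ℓ
  Sim zero       s t = s ≃ t
  Sim (succ α)   s t = ∀ x → Sim α (app s (el x)) (app t (el x))
  Sim (lim I _ f) s t = Σ I λ i → Sim (f i) s t

  -- s ≈ t   (equivalently: ord_C(s,t) < ∞)
  Approx : Term Carrier → Term Carrier → Set (lsuc ℓ)
  Approx s t = Σ (Ord ℓ) λ γ → Sim γ s t

  IsOrd : Term Carrier → Term Carrier → Ord∞ ℓ → Set (lsuc ℓ)
  IsOrd s t (fin α) = Sim α s t × (∀ β → Sim β s t → α ≤ₒ β)
  IsOrd s t ∞       = ∀ β → ¬ Sim β s t

  Stable : Ord ℓ → Set ℓ
  Stable α = ∀ s t → Sim α s t ⇔ Sim (succ α) s t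

  IsOrdPCA : Ord ℓ → Set (lsuc ℓ)
  IsOrdPCA α = Stable α × (∀ β → Stable β → α ≤ₒ β)

{-# OPTIONS --safe #-}
module Submission where

-- Restricting ∼_γ from B to A is harmless: application in A is that of B, and
-- the arguments quantified over in A are among those in B. This gives (i), and
-- (ii) since stability of ∼_β in B then descends to A. For (iii), the term s is
-- replaced by an element e with e x ≃ s for all x (from K and S), so that
-- s ∼_γ t gives e ∼_{γ+1} e′ and conversely e ≈ e′ gives s ≈ t; thus the
-- hypothesis on elements implies the one of (ii).

open import Defs
open import Level using (Level)
open import Data.Product using (_×_; Σ; _,_)
open import Data.Maybe using (Maybe; just; nothing; map; _>>=_)
open import Data.Maybe.Properties using (just-injective; map-injective)
open import Relation.Nullary using (¬_)
open import Relation.Binary.PropositionalEquality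
open import Function using (mk⇔; case_of_)
open import Function.Bundles using (Equivalence)
import Data.Unit.Polymorphic as U
open import Data.Empty using (⊥-elim)

module PCAProperties {ℓ : Level} (C : PCA ℓ) where
  open PCA C

  app-el-cong : ∀ {m n : Maybe Carrier} x → m ≡ n → (m >>= λ a → a · x) ≡ (n >>= λ a → a · x)
  app-el-cong x = cong (_>>= λ a → a · x)

  Sim-resp-≃ : ∀ γ {s t s′ t′} → s ≃ s′ → t ≃ t′ → Sim C γ s t → Sim C γ s′ t′
  Sim-resp-≃ zero        s≃s′ t≃t′ s≃t       = trans (sym s≃s′) (trans s≃t t≃t′)
  Sim-resp-≃ (succ γ)    s≃s′ t≃t′ s∼t x     = Sim-resp-≃ γ (app-el-cong x s≃s′) (app-el-cong x t≃t′) (s∼t x)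
  Sim-resp-≃ (lim _ _ f) s≃s′ t≃t′ (i , s∼t) = i , Sim-resp-≃ (f i) s≃s′ t≃t′ s∼t

  ≃⇒Sim : ∀ γ {s t} → s ≃ t → Sim C γ s t
  ≃⇒Sim zero        s≃t   = s≃t
  ≃⇒Sim (succ γ)    s≃t x = ≃⇒Sim γ (app-el-cong x s≃t)
  ≃⇒Sim (lim _ i f) s≃t   = i , ≃⇒Sim (f i) s≃t

  Sim⇒Sim-succ : ∀ γ {s t} → Sim C γ s t → Sim C (succ γ) s t
  Sim⇒Sim-succ zero        s≃t       x = app-el-cong x s≃t
  Sim⇒Sim-succ (succ γ)    s∼t       x = Sim⇒Sim-succ γ (s∼t x)
  Sim⇒Sim-succ (lim _ _ f) (i , s∼t) x = i , Sim⇒Sim-succ (f i) s∼t x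

  Stable⇒Sim : ∀ {β} → Stable C β → ∀ γ {s t} → Sim C γ s t → Sim C β s t
  Stable⇒Sim {β} _      zero        s≃t       = ≃⇒Sim β s≃t
  Stable⇒Sim     stable (succ γ)    s∼t       =
    Equivalence.from (stable _ _) (λ x → Stable⇒Sim stable γ (s∼t x))
  Stable⇒Sim     stable (lim _ _ f) (i , s∼t) = Stable⇒Sim stable (f i) s∼t

  constant : (c : Carrier) → Σ Carrier λ k → ∀ x → k · x ≡ just c
  constant c with K · c | K-ax c
  ... | just k  | Kcx≡c = k , Kcx≡c
  ... | nothing | Kcx≡c = case Kcx≡c c of λ ()

  substitution : (a b : Carrier) → Σ Carrier λ v → ∀ x →
                 v · x ≡ (a · x >>= λ p → b · x >>= λ q → p · q)
  substitution a b with S · a | S-def a b | S-ax a b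
  ... | nothing | Sab↓ | _ = ⊥-elim (Sab↓ refl)
  ... | just u  | Sab↓ | Sabx with u · b | Sab↓ | Sabx
  ...   | nothing | Sab↓′ | _     = ⊥-elim (Sab↓′ refl)
  ...   | just v  | _     | Sabx′ = v , Sabx′

  abstraction : (s : Term Carrier) → Σ Carrier λ e → ∀ x → e · x ≡ eval s
  abstraction (el c)    = constant c
  abstraction (app p q) with abstraction p | abstraction q
  ... | ep , epx≡p | eq , eqx≡q with substitution ep eq
  ...   | v , vx≡ = v , λ x → trans (vx≡ x)
            (cong₂ (λ m n → m >>= λ a → n >>= λ b → a · b) (epx≡p x) (eqx≡q x))

module SubPCAProperties {ℓ : Level} (A B : PCA ℓ) (H : SubPCA A B) where
  open SubPCA H
  private
    module A = PCA A
    module B = PCA B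
    module PA = PCAProperties A
    module PB = PCAProperties B

  eval-ιT : ∀ s → B.eval (ιT s) ≡ map ι (A.eval s)
  eval-ιT (el a) = refl
  eval-ιT (app p q) rewrite eval-ιT p | eval-ιT q with A.eval p | A.eval q
  ... | nothing | _      = refl
  ... | just a  | nothing = refl
  ... | just a  | just b  = sym (ι-app a b)

  Sim-reflect : ∀ γ {s t} → Sim B γ (ιT s) (ιT t) → Sim A γ s t
  Sim-reflect zero {s} {t} s≃t =
    map-injective (ι-inj _ _) (trans (sym (eval-ιT s)) (trans s≃t (eval-ιT t)))
  Sim-reflect (succ γ)    s∼t x     = Sim-reflect γ (s∼t (ι x))
  Sim-reflect (lim _ _ f) (i , s∼t) = i , Sim-reflect (f i) s∼t

  ord-mono : ∀ s t oA oB → IsOrd A s t oA → IsOrd B (ιT s) (ιT t) oB → oA ≤∞ oB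
  ord-mono s t (fin _) ∞       _           _       = U.tt
  ord-mono s t ∞       ∞       _           _       = U.tt
  ord-mono s t (fin α) (fin β) (_ , least) (s∼t , _) = least β (Sim-reflect β s∼t)
  ord-mono s t ∞       (fin β) s≉t         (s∼t , _) = ⊥-elim (s≉t β (Sim-reflect β s∼t))

  ordPCA-mono : (∀ s t → Approx A s t → Approx B (ιT s) (ιT t)) →
                ∀ α β → IsOrdPCA A α → IsOrdPCA B β → α ≤ₒ β
  ordPCA-mono ≈-preserved α β (_ , least) (stableB , _) =
    least β (λ s t → mk⇔ (PA.Sim⇒Sim-succ β) (stable-β s t))
    where
    stable-β : ∀ s t → Sim A (succ β) s t → Sim A β s t
    stable-β s t s∼t with ≈-preserved s t (succ β , s∼t)
    ... | γ , ιs∼ιt = Sim-reflect β (PB.Stable⇒Sim stableB γ ιs∼ιt)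

  ι-abstraction : ∀ s {e} → (∀ x → e A.· x ≡ A.eval s) → ∀ x → ι e B.· ι x ≡ B.eval (ιT s)
  ι-abstraction s {e} ex≡s x =
    trans (sym (ι-app e x)) (trans (cong (map ι) (ex≡s x)) (sym (eval-ιT s)))

  -- Applying both sides to (the image of) K recovers s ≈ t from e ≈ e′;
  -- at level 0 the elements are equal, and again so are their values at K.
  Approx-from-abstraction : ∀ s t {e e′} → (∀ x → e A.· x ≡ A.eval s) →
    (∀ x → e′ A.· x ≡ A.eval t) →
    ∀ γ → Sim B γ (el (ι e)) (el (ι e′)) → Approx B (ιT s) (ιT t)
  Approx-from-abstraction s t {e} {e′} ex≡s e′x≡t zero ιe≡ιe′ =
    zero , trans (sym (ι-abstraction s ex≡s A.K))
             (trans (cong (λ f → ι f B.· ι A.K) e≡e′) (ι-abstraction t e′x≡t A.K))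
    where
    e≡e′ : e ≡ e′
    e≡e′ = ι-inj e e′ (just-injective ιe≡ιe′)
  Approx-from-abstraction s t ex≡s e′x≡t (succ γ) ιe∼ιe′ =
    γ , PB.Sim-resp-≃ γ (ι-abstraction s ex≡s A.K) (ι-abstraction t e′x≡t A.K) (ιe∼ιe′ (ι A.K))
  Approx-from-abstraction s t ex≡s e′x≡t (lim _ _ f) (i , ιe∼ιe′) =
    Approx-from-abstraction s t ex≡s e′x≡t (f i) ιe∼ιe′

  Approx-preserved-on-terms :
    (∀ a b → Approx A (el a) (el b) → Approx B (el (ι a)) (el (ι b))) →
    ∀ s t → Approx A s t → Approx B (ιT s) (ιT t)
  Approx-preserved-on-terms ≈-preserved s t (γ , s∼t)
    with PA.abstraction s | PA.abstraction t
  ... | e , ex≡s | e′ , e′x≡t with ≈-preserved e e′ (succ γ , e∼e′)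
    where
    e∼e′ : Sim A (succ γ) (el e) (el e′)
    e∼e′ x = PA.Sim-resp-≃ γ (sym (ex≡s x)) (sym (e′x≡t x)) s∼t
  ... | γ′ , ιe∼ιe′ = Approx-from-abstraction s t ex≡s e′x≡t γ′ ιe∼ιe′

proposition8p7 : ∀ {ℓ : Level} (A B : PCA ℓ) (H : SubPCA A B) →
    let open SubPCA H in
    -- (i)
    (∀ s t oA oB → IsOrd A s t oA → IsOrd B (ιT s) (ιT t) oB → oA ≤∞ oB)
    × -- (ii)
    ((∀ s t → Approx A s t → Approx B (ιT s) (ιT t)) →
      ∀ α β → IsOrdPCA A α → IsOrdPCA B β → α ≤ₒ β)
    × -- (iii)
    (¬ PCA.Extensional A → ¬ PCA.Extensional B →
      (∀ a b → Approx A (el a) (el b) → Approx B (el (ι a)) (el (ι b))) →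
      ∀ α β → IsOrdPCA A α → IsOrdPCA B β → α ≤ₒ β)
proposition8p7 A B H =
    ord-mono
  , ordPCA-mono
  , λ _ _ ≈-preserved → ordPCA-mono (Approx-preserved-on-terms ≈-preserved)
  where open SubPCAProperties A B H
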